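{- Let $m$ be an integer such that $m$ and $m+1$ are both non-squares, let $M=\mathbb{Z}[\sqrt{m},\sqrt{m+1}]$, let $\eta=\sqrt{m}+\sqrt{m+1}$ and $K=\mathbb{Q}(\eta)$. Then $\eta$ lies in the positive unit group $\mathcal{U}_M^+$, $\eta^2$ is a unit in a quadratic subfield of $K$, and there is an explicitly constructible $\mathbb{Z}$-basis $W=\{w_1,w_2,w_3,w_4\}$ of $M$ such that, writing $\eta^k=x_1(k)w_1+\cdots+x_4(k)w_4$ with $x_i(k)\in\mathbb{Z}$, the sequence $\{x_1(k):k\in\mathbb{Z}_{\ge 0}\}$ is a linear divisibility sequence.
   Context: For a $\mathbb{Z}$-module $M$ in a number field $K$, the coefficient ring is $\mathcal{O}_M=\{\alpha\in K:\alpha M\subseteq M\}$ and the positive unit group is $\mathcal{U}_M^+=\{\epsilon\in\mathcal{O}_M: N_{K/\mathbb{Q}}(\epsilon)=1\}$. A linear divisibility sequence (LDS) is an integer sequence $b(k)$ satisfying a linear homogeneous recurrence with constant coefficients such that for all positive integers $n,m$, $n\mid m$ implies $b(n)\mid b(m)$. -}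

module Defs where

open import Data.Nat using (ℕ; zero; suc) renaming (_+_ to _+ℕ_; _≥_ to _≥ℕ_)
open import Data.Integer as ℤ using (ℤ; +_)
open import Data.Integer.Divisibility using () renaming (_∣_ to _∣ℤ_)
open import Data.Rational as ℚ using (ℚ; _/_; 0ℚ; 1ℚ)
open import Data.Fin using (Fin; zero; suc; toℕ)
open import Data.Product using (Σ; ∃; _×_)
open import Relation.Binary.PropositionalEquality using (_≡_)
open import Relation.Nullary using (¬_)

ℤ→ℚ : ℤ → ℚ
ℤ→ℚ z = z / 1

IsSquare : ℤ → Set
IsSquare m = ∃ λ z → z ℤ.* z ≡ m

-- Elements of K = Q(√m, √(m+1)) written as
--   a + b·√m + c·√(m+1) + d·√m·√(m+1)   with a b c d ∈ ℚ.
-- (Under the hypotheses of the theorem, {1, √m, √(m+1), √m√(m+1)} is a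
-- Q-basis of K = Q(η), η = √m + √(m+1), so this is a faithful model of K.)
record K4 : Set where
  constructor ⟨_,_,_,_⟩
  field
    a b c d : ℚ
open K4 public

module Field (m : ℤ) where
  mℚ m1ℚ : ℚ
  mℚ  = ℤ→ℚ m
  m1ℚ = ℤ→ℚ (m ℤ.+ + 1)

  infixl 6 _⊕_
  infixl 7 _⊛_

  _⊕_ : K4 → K4 → K4
  ⟨ a , b , c , d ⟩ ⊕ ⟨ a' , b' , c' , d' ⟩ =
    ⟨ a ℚ.+ a' , b ℚ.+ b' , c ℚ.+ c' , d ℚ.+ d' ⟩

  -- multiplication using (√m)² = m, (√(m+1))² = m+1
  _⊛_ : K4 → K4 → K4
  ⟨ a , b , c , d ⟩ ⊛ ⟨ a' , b' , c' , d' ⟩ =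
    ⟨ a ℚ.* a' ℚ.+ mℚ ℚ.* (b ℚ.* b') ℚ.+ m1ℚ ℚ.* (c ℚ.* c')
        ℚ.+ (mℚ ℚ.* m1ℚ) ℚ.* (d ℚ.* d')
    , a ℚ.* b' ℚ.+ b ℚ.* a' ℚ.+ m1ℚ ℚ.* (c ℚ.* d' ℚ.+ d ℚ.* c')
    , a ℚ.* c' ℚ.+ c ℚ.* a' ℚ.+ mℚ ℚ.* (b ℚ.* d' ℚ.+ d ℚ.* b')
    , a ℚ.* d' ℚ.+ d ℚ.* a' ℚ.+ b ℚ.* c' ℚ.+ c ℚ.* b' ⟩

  zeroK oneK : K4
  zeroK = ⟨ 0ℚ , 0ℚ , 0ℚ , 0ℚ ⟩
  oneK  = ⟨ 1ℚ , 0ℚ , 0ℚ , 0ℚ ⟩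

  _·_ : ℤ → K4 → K4
  z · ⟨ a , b , c , d ⟩ =
    ⟨ ℤ→ℚ z ℚ.* a , ℤ→ℚ z ℚ.* b , ℤ→ℚ z ℚ.* c , ℤ→ℚ z ℚ.* d ⟩

  _^_ : K4 → ℕ → K4
  x ^ zero  = oneK
  x ^ suc k = x ⊛ (x ^ k)

  η : K4
  η = ⟨ 0ℚ , 1ℚ , 1ℚ , 0ℚ ⟩

  σ₁ σ₂ σ₃ : K4 → K4
  σ₁ ⟨ a , b , c , d ⟩ = ⟨ a , ℚ.- b , c , ℚ.- d ⟩
  σ₂ ⟨ a , b , c , d ⟩ = ⟨ a , b , ℚ.- c , ℚ.- d ⟩
  σ₃ ⟨ a , b , c , d ⟩ = ⟨ a , ℚ.- b , ℚ.- c , d ⟩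

  -- N_{K/Q}(x) = product of the Galois conjugates of x (a rational number,
  -- i.e. the √-components of the product vanish; we read off the rational part)
  norm : K4 → ℚ
  norm x = a (x ⊛ σ₁ x ⊛ σ₂ x ⊛ σ₃ x)

  InM : K4 → Set
  InM x = Σ ℤ λ p → Σ ℤ λ q → Σ ℤ λ r → Σ ℤ λ s →
          x ≡ ⟨ ℤ→ℚ p , ℤ→ℚ q , ℤ→ℚ r , ℤ→ℚ s ⟩

  InCoeffRing : K4 → Set
  InCoeffRing α = ∀ x → InM x → InM (α ⊛ x)

  InPosUnits : K4 → Set
  InPosUnits ε = InCoeffRing ε × norm ε ≡ 1ℚ

  -- the quadratic subfield L = Q(√(m(m+1))) = Q(√m·√(m+1)) of K
  InL : K4 → Set
  InL x = b x ≡ 0ℚ × c x ≡ 0ℚ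

  IsUnitInL : K4 → Set
  IsUnitInL x = InL x × InM x × Σ K4 λ y → InL y × InM y × x ⊛ y ≡ oneK

  lincomb : (Fin 4 → ℤ) → (Fin 4 → K4) → K4
  lincomb z w = z zero · w zero ⊕ z (suc zero) · w (suc zero)
              ⊕ z (suc (suc zero)) · w (suc (suc zero))
              ⊕ z (suc (suc (suc zero))) · w (suc (suc (suc zero)))

  IsZBasisM : (Fin 4 → K4) → Set
  IsZBasisM w = (∀ i → InM (w i))
              × (∀ x → InM x → Σ (Fin 4 → ℤ) λ z → x ≡ lincomb z w)
              × (∀ z → lincomb z w ≡ zeroK → ∀ i → z i ≡ + 0)

sumℤ : ∀ {d} → (Fin d → ℤ) → ℤ
sumℤ {zero}  f = + 0
sumℤ {suc d} f = f zero ℤ.+ sumℤ (λ i → f (suc i))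

LinRec : (ℕ → ℤ) → Set
LinRec b = Σ ℕ λ d → Σ (Fin d → ℤ) λ c →
           ∀ n → b (n +ℕ d) ≡ sumℤ (λ i → c i ℤ.* b (n +ℕ toℕ i))

DivSeq : (ℕ → ℤ) → Set
DivSeq b = ∀ n k → n ≥ℕ 1 → k ≥ℕ 1 → (Σ ℕ λ t → k ≡ t Data.Nat.* n) → b n ∣ℤ b k

IsLDS : (ℕ → ℤ) → Set
IsLDS b = LinRec b × DivSeq b

module Submission where

open import Defs
open import Data.Integer using (ℤ; +_; _+_)
open import Data.Nat using (ℕ)
open import Data.Fin using (Fin; zero)
open import Data.Product using (Σ; _×_)
open import Relation.Binary.PropositionalEquality using (_≡_)
open import Relation.Nullary using (¬_)

open import Level using (0ℓ)
open import Algebra.Bundles using (Monoid)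
open import Algebra.Bundles.Raw using (RawSemiring)
import Algebra.Definitions.RawSemiring as SemiringDefinitions
import Algebra.Properties.Monoid.Mult as MonoidPowers
import Data.Integer as ℤ
open import Data.Integer using (-[1+_]; -1ℤ)
open import Data.Integer.Divisibility.Signed
  using (divides; ∣-refl; ∣n⇒∣m*n; ∣m⇒∣m*n; ∣m∣n⇒∣m+n; ∣⇒∣ᵤ)
  renaming (_∣_ to _∣ₛ_)
import Data.Integer.Properties as ℤP
open import Data.Integer.Tactic.RingSolver using (ring; solve-∀)
import Data.Nat as ℕ
import Data.Nat.Properties as ℕP
open import Data.Nat.Coprimality using (1-coprimeTo) renaming (sym to coprime-sym)
open import Data.Fin using (suc; toℕ; #_)
open import Data.Product using (_,_; proj₁)
open import Data.Rational as ℚ using (ℚ; mkℚ)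
open import Data.Rational.Properties using (↥p/↧p≡p)
open import Data.Sum using (_⊎_; inj₁; inj₂)
open import Data.Vec using (Vec; []; _∷_; _++_; map; tabulate)
open import Data.Vec.Properties using (lookup-map)
open import Relation.Binary.PropositionalEquality
  using (refl; sym; trans; cong; cong₂; subst; isEquivalence; module ≡-Reasoning)
open import Tactic.RingSolver.Core.Expression using (module Eval)
open import Tactic.RingSolver.NonReflective ring
  using (Expr; Κ; Ι; module Ops)
  renaming (_⊕_ to _:+_; _⊗_ to _:*_; ⊝_ to :-_; _⊛_ to _:^_)
open Ops using (⟦_⟧; ⟦_⇓⟧; prove)

-- Write μ = m and ν = m + 1, so that η = √μ + √ν.  The ring
-- M = ℤ[√μ, √ν] is modelled by the type  Quad ℤ  of coefficient vectors
-- (a, b, c, d) standing for a + b√μ + c√ν + d√μ√ν, with the multiplication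
-- table of the formal biquadratic algebra, defined once over an arbitrary
-- raw semiring.
-- The theorem then assembles: η ∈ M has norm (ν − μ)² = 1;
-- η² = (2m + 1) + 2√m√(m+1) with inverse (2m + 1) − 2√m√(m+1); the basis is
-- (√m, 1, √(m+1), √m√(m+1)); and x satisfies x(k + 4) = (4m + 2) x(k + 2) − x(k),
-- i.e. η⁴ − (4m + 2)η² + 1 = 0.

ℤ→ℚ-canonical : ∀ z → ℤ→ℚ z ≡ mkℚ z 0 (coprime-sym (1-coprimeTo ℤ.∣ z ∣))
ℤ→ℚ-canonical z = ↥p/↧p≡p (mkℚ z 0 (coprime-sym (1-coprimeTo ℤ.∣ z ∣)))

ℤ→ℚ-injective : ∀ {x y} → ℤ→ℚ x ≡ ℤ→ℚ y → x ≡ y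
ℤ→ℚ-injective {x} {y} eq =
  cong ℚ.↥_ (trans (sym (ℤ→ℚ-canonical x)) (trans eq (ℤ→ℚ-canonical y)))

ℤ→ℚ-* : ∀ x y → ℤ→ℚ (x ℤ.* y) ≡ ℤ→ℚ x ℚ.* ℤ→ℚ y
ℤ→ℚ-* x y = sym (cong₂ ℚ._*_ (ℤ→ℚ-canonical x) (ℤ→ℚ-canonical y))

ℤ→ℚ-+ : ∀ x y → ℤ→ℚ (x ℤ.+ y) ≡ ℤ→ℚ x ℚ.+ ℤ→ℚ y
ℤ→ℚ-+ x y = begin
  ℤ→ℚ (x ℤ.+ y)
    ≡⟨ cong ℤ→ℚ (sym (cong₂ ℤ._+_ (ℤP.*-identityʳ x) (ℤP.*-identityʳ y))) ⟩
  ℤ→ℚ (x ℤ.* + 1 ℤ.+ y ℤ.* + 1)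
    ≡⟨ sym (cong₂ ℚ._+_ (ℤ→ℚ-canonical x) (ℤ→ℚ-canonical y)) ⟩
  ℤ→ℚ x ℚ.+ ℤ→ℚ y ∎
  where open ≡-Reasoning

ℤ→ℚ-neg : ∀ x → ℤ→ℚ (ℤ.- x) ≡ ℚ.- ℤ→ℚ x
ℤ→ℚ-neg x = trans (ℤ→ℚ-canonical (ℤ.- x))
                  (trans (negate-canonical x) (cong ℚ.-_ (sym (ℤ→ℚ-canonical x))))
  where
  negate-canonical : ∀ x → mkℚ (ℤ.- x) 0 (coprime-sym (1-coprimeTo ℤ.∣ ℤ.- x ∣))
                         ≡ ℚ.- mkℚ x 0 (coprime-sym (1-coprimeTo ℤ.∣ x ∣))
  negate-canonical (+ ℕ.zero)  = refl
  negate-canonical (+ ℕ.suc _) = refl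
  negate-canonical -[1+ _ ]    = refl

module _ where
  open SemiringDefinitions ℤ.+-*-rawSemiring using () renaming (_^′_ to _^ℤ_)
  open SemiringDefinitions ℚ.+-*-rawSemiring using () renaming (_^′_ to _^ℚ_)

  ℤ→ℚ-^ : ∀ {x X} → ℤ→ℚ x ≡ X → ∀ n → ℤ→ℚ (x ^ℤ n) ≡ X ^ℚ n
  ℤ→ℚ-^ x≡X 0                 = refl
  ℤ→ℚ-^ x≡X 1                 = x≡X
  ℤ→ℚ-^ {x} x≡X (ℕ.suc (ℕ.suc n)) =
    trans (ℤ→ℚ-* (x ^ℤ ℕ.suc n) x) (cong₂ ℚ._*_ (ℤ→ℚ-^ x≡X (ℕ.suc n)) x≡X)

open Eval ℚ.+-*-rawRing ℤ→ℚ using () renaming (⟦_⟧ to ⟦_⟧ℚ)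

ℤ→ℚ-⟦⟧ : ∀ {n} (e : Expr ℤ n) ρ → ℤ→ℚ (⟦ e ⟧ ρ) ≡ ⟦ e ⟧ℚ (map ℤ→ℚ ρ)
ℤ→ℚ-⟦⟧ (Κ x)    ρ = refl
ℤ→ℚ-⟦⟧ (Ι i)    ρ = sym (lookup-map i ℤ→ℚ ρ)
ℤ→ℚ-⟦⟧ (e :+ f) ρ = trans (ℤ→ℚ-+ (⟦ e ⟧ ρ) (⟦ f ⟧ ρ)) (cong₂ ℚ._+_ (ℤ→ℚ-⟦⟧ e ρ) (ℤ→ℚ-⟦⟧ f ρ))
ℤ→ℚ-⟦⟧ (e :* f) ρ = trans (ℤ→ℚ-* (⟦ e ⟧ ρ) (⟦ f ⟧ ρ)) (cong₂ ℚ._*_ (ℤ→ℚ-⟦⟧ e ρ) (ℤ→ℚ-⟦⟧ f ρ))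
ℤ→ℚ-⟦⟧ (e :^ k) ρ = ℤ→ℚ-^ (ℤ→ℚ-⟦⟧ e ρ) k
ℤ→ℚ-⟦⟧ (:- e)   ρ = trans (ℤ→ℚ-neg (⟦ e ⟧ ρ)) (cong ℚ.-_ (ℤ→ℚ-⟦⟧ e ρ))

-- Formal elements a + b√μ + c√ν + d√μ√ν with coefficients in A.
record Quad (A : Set) : Set where
  constructor quad
  field
    c₀ cμ cν cμν : A
open Quad

quad-cong : ∀ {A : Set} {a b c d a′ b′ c′ d′ : A} →
            a ≡ a′ → b ≡ b′ → c ≡ c′ → d ≡ d′ → quad a b c d ≡ quad a′ b′ c′ d′
quad-cong refl refl refl refl = refl

module QuadLinear (R : RawSemiring 0ℓ 0ℓ) where
  open RawSemiring R using (Carrier; 0#; 1#) renaming (_+_ to _+ᴿ_; _*_ to _*ᴿ_)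

  infixl 6 _⊞_
  infixl 7 _⋆_

  _⊞_ : Quad Carrier → Quad Carrier → Quad Carrier
  quad a b c d ⊞ quad a′ b′ c′ d′ = quad (a +ᴿ a′) (b +ᴿ b′) (c +ᴿ c′) (d +ᴿ d′)

  _⋆_ : Carrier → Quad Carrier → Quad Carrier
  z ⋆ quad a b c d = quad (z *ᴿ a) (z *ᴿ b) (z *ᴿ c) (z *ᴿ d)

  combination : (Fin 4 → Carrier) → (Fin 4 → Quad Carrier) → Quad Carrier
  combination z w = z zero ⋆ w zero ⊞ z (suc zero) ⋆ w (suc zero)
                  ⊞ z (suc (suc zero)) ⋆ w (suc (suc zero))
                  ⊞ z (suc (suc (suc zero))) ⋆ w (suc (suc (suc zero)))

  -- the basis (√μ, 1, √ν, √μ√ν): the √μ-coordinate comes first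
  basis : Fin 4 → Quad Carrier
  basis zero                   = quad 0# 1# 0# 0#
  basis (suc zero)             = quad 1# 0# 0# 0#
  basis (suc (suc zero))       = quad 0# 0# 1# 0#
  basis (suc (suc (suc zero))) = quad 0# 0# 0# 1#

  𝟙 η̂ : Quad Carrier
  𝟙 = quad 1# 0# 0# 0#
  η̂ = quad 0# 1# 1# 0#

module QuadArith (R : RawSemiring 0ℓ 0ℓ) (μ ν : RawSemiring.Carrier R) where
  open RawSemiring R using (Carrier) renaming (_+_ to _+ᴿ_; _*_ to _*ᴿ_)
  open QuadLinear R public

  infixl 7 _⊠_

  _⊠_ : Quad Carrier → Quad Carrier → Quad Carrier
  quad a b c d ⊠ quad a′ b′ c′ d′ =
    quad (a *ᴿ a′ +ᴿ μ *ᴿ (b *ᴿ b′) +ᴿ ν *ᴿ (c *ᴿ c′) +ᴿ (μ *ᴿ ν) *ᴿ (d *ᴿ d′))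
         (a *ᴿ b′ +ᴿ b *ᴿ a′ +ᴿ ν *ᴿ (c *ᴿ d′ +ᴿ d *ᴿ c′))
         (a *ᴿ c′ +ᴿ c *ᴿ a′ +ᴿ μ *ᴿ (b *ᴿ d′ +ᴿ d *ᴿ b′))
         (a *ᴿ d′ +ᴿ d *ᴿ a′ +ᴿ b *ᴿ c′ +ᴿ c *ᴿ b′)

exprSemiring : ℕ → RawSemiring 0ℓ 0ℓ
exprSemiring n = record
  { Carrier = Expr ℤ n ; _≈_ = _≡_ ; _+_ = _:+_ ; _*_ = _:*_
  ; 0# = Κ (+ 0) ; 1# = Κ (+ 1) }

coefficients : ∀ {A} → Quad A → Vec A 4
coefficients (quad a b c d) = a ∷ b ∷ c ∷ d ∷ []

constant : ∀ {n} → Quad ℤ → Quad (Expr ℤ n)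
constant (quad a b c d) = quad (Κ a) (Κ b) (Κ c) (Κ d)

⟦_⟧Q ⟦_⇓⟧Q : ∀ {n} → Quad (Expr ℤ n) → Vec ℤ n → Quad ℤ
⟦ quad a b c d ⟧Q ρ = quad (⟦ a ⟧ ρ) (⟦ b ⟧ ρ) (⟦ c ⟧ ρ) (⟦ d ⟧ ρ)
⟦ quad a b c d ⇓⟧Q ρ = quad (⟦ a ⇓⟧ ρ) (⟦ b ⇓⟧ ρ) (⟦ c ⇓⟧ ρ) (⟦ d ⇓⟧ ρ)

-- Since the operations of
-- QuadArith evaluate definitionally, an identity in Quad ℤ follows by
-- instantiating QuadArith at exprSemiring and supplying refl here.
by-normalisation : ∀ {n} (ρ : Vec ℤ n) (L R : Quad (Expr ℤ n)) →
                   ⟦ L ⇓⟧Q ρ ≡ ⟦ R ⇓⟧Q ρ → ⟦ L ⟧Q ρ ≡ ⟦ R ⟧Q ρ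
by-normalisation ρ (quad a b c d) (quad a′ b′ c′ d′) eq =
  quad-cong (prove ρ a a′ (cong c₀ eq)) (prove ρ b b′ (cong cμ eq))
            (prove ρ c c′ (cong cν eq)) (prove ρ d d′ (cong cμν eq))

emb : Quad ℤ → K4
emb (quad a b c d) = ⟨ ℤ→ℚ a , ℤ→ℚ b , ℤ→ℚ c , ℤ→ℚ d ⟩

emb-injective : ∀ {u v} → emb u ≡ emb v → u ≡ v
emb-injective {quad _ _ _ _} {quad _ _ _ _} eq =
  quad-cong (ℤ→ℚ-injective (cong a eq)) (ℤ→ℚ-injective (cong b eq))
            (ℤ→ℚ-injective (cong c eq)) (ℤ→ℚ-injective (cong d eq))

K4-cong : ∀ {p q r s p′ q′ r′ s′} → p ≡ p′ → q ≡ q′ → r ≡ r′ → s ≡ s′ →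
          ⟨ p , q , r , s ⟩ ≡ ⟨ p′ , q′ , r′ , s′ ⟩
K4-cong refl refl refl refl = refl

-- A symbolic element evaluated in ℚ; the operations of K4 are these
-- evaluations of the operations of QuadArith.
⟦_⟧K4 : ∀ {n} → Quad (Expr ℤ n) → Vec ℚ n → K4
⟦ quad a b c d ⟧K4 ρ = ⟨ ⟦ a ⟧ℚ ρ , ⟦ b ⟧ℚ ρ , ⟦ c ⟧ℚ ρ , ⟦ d ⟧ℚ ρ ⟩

emb-⟦⟧ : ∀ {n} (L : Quad (Expr ℤ n)) ρ → emb (⟦ L ⟧Q ρ) ≡ ⟦ L ⟧K4 (map ℤ→ℚ ρ)
emb-⟦⟧ (quad a b c d) ρ = K4-cong (ℤ→ℚ-⟦⟧ a ρ) (ℤ→ℚ-⟦⟧ b ρ) (ℤ→ℚ-⟦⟧ c ρ) (ℤ→ℚ-⟦⟧ d ρ)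

-- Quad ℤ is a monoid under ⊠ for all μ, ν (a tensor product of two
-- quadratic algebras).
module QuadMonoid (μ ν : ℤ) where
  open QuadArith ℤ.+-*-rawSemiring μ ν

  private
    module S = QuadArith (exprSemiring 14) (Ι (# 0)) (Ι (# 1))
    U V W : Quad (Expr ℤ 14)
    U = quad (Ι (# 2)) (Ι (# 3)) (Ι (# 4)) (Ι (# 5))
    V = quad (Ι (# 6)) (Ι (# 7)) (Ι (# 8)) (Ι (# 9))
    W = quad (Ι (# 10)) (Ι (# 11)) (Ι (# 12)) (Ι (# 13))
    -- μ, ν and the coefficients of three elements (unused ones padded by 𝟙)
    valuation : Quad ℤ → Quad ℤ → Quad ℤ → Vec ℤ 14
    valuation u v w = μ ∷ ν ∷ coefficients u ++ coefficients v ++ coefficients w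

  ⊠-assoc : ∀ u v w → (u ⊠ v) ⊠ w ≡ u ⊠ (v ⊠ w)
  ⊠-assoc u v w = by-normalisation (valuation u v w) ((U S.⊠ V) S.⊠ W) (U S.⊠ (V S.⊠ W)) refl

  ⊠-identityˡ : ∀ u → 𝟙 ⊠ u ≡ u
  ⊠-identityˡ u = by-normalisation (valuation u 𝟙 𝟙) (S.𝟙 S.⊠ U) U refl

  ⊠-identityʳ : ∀ u → u ⊠ 𝟙 ≡ u
  ⊠-identityʳ u = by-normalisation (valuation u 𝟙 𝟙) (U S.⊠ S.𝟙) U refl

  quadMonoid : Monoid 0ℓ 0ℓ
  quadMonoid = record
    { Carrier = Quad ℤ ; _≈_ = _≡_ ; _∙_ = _⊠_ ; ε = 𝟙
    ; isMonoid = record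
      { isSemigroup = record
        { isMagma = record { isEquivalence = isEquivalence ; ∙-cong = cong₂ _⊠_ }
        ; assoc = ⊠-assoc }
      ; identity = ⊠-identityˡ , ⊠-identityʳ } }

  -- power k x = x ⊠ (x ⊠ ⋯ (x ⊠ 𝟙))  (k factors)
  open MonoidPowers quadMonoid public using (×-assocˡ) renaming (_×_ to power)

  powers-closed : (S : Quad ℤ → Set) → S 𝟙 → (∀ x y → S x → S y → S (x ⊠ y)) →
                  ∀ {x} → S x → ∀ t → S (power t x)
  powers-closed S S𝟙 S⊠ Sx ℕ.zero    = S𝟙
  powers-closed S S𝟙 S⊠ Sx (ℕ.suc t) = S⊠ _ _ Sx (powers-closed S S𝟙 S⊠ Sx t)

infixl 6 _∣+_
infix  7 _*∣_ _∣*_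

_∣+_ : ∀ {q x y} → q ∣ₛ x → q ∣ₛ y → q ∣ₛ x ℤ.+ y
_∣+_ = ∣m∣n⇒∣m+n

_*∣_ : ∀ {q y} x → q ∣ₛ y → q ∣ₛ x ℤ.* y
x *∣ q∣y = ∣n⇒∣m*n x q∣y

_∣*_ : ∀ {q x} → q ∣ₛ x → ∀ y → q ∣ₛ x ℤ.* y
q∣x ∣* y = ∣m⇒∣m*n y q∣x

∣-zero : ∀ {q} → q ∣ₛ + 0
∣-zero = divides (+ 0) refl

module Grading (μ ν : ℤ) where
  open QuadArith ℤ.+-*-rawSemiring μ ν

  Even Odd : Quad ℤ → Set
  Even u = cμ u ≡ + 0 × cν u ≡ + 0
  Odd  u = c₀ u ≡ + 0 × cμν u ≡ + 0

  private
    module S = QuadArith (exprSemiring 4) (Ι (# 0)) (Ι (# 1))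

  η-on-even : ∀ a d → η̂ ⊠ quad a (+ 0) (+ 0) d ≡ quad (+ 0) (a + ν ℤ.* d) (a + μ ℤ.* d) (+ 0)
  η-on-even a d = by-normalisation (μ ∷ ν ∷ a ∷ d ∷ [])
    (S.η̂ S.⊠ quad (Ι (# 2)) (Κ (+ 0)) (Κ (+ 0)) (Ι (# 3)))
    (quad (Κ (+ 0)) (Ι (# 2) :+ Ι (# 1) :* Ι (# 3)) (Ι (# 2) :+ Ι (# 0) :* Ι (# 3)) (Κ (+ 0)))
    refl

  η-on-odd : ∀ b c → η̂ ⊠ quad (+ 0) b c (+ 0) ≡ quad (μ ℤ.* b + ν ℤ.* c) (+ 0) (+ 0) (c + b)
  η-on-odd b c = by-normalisation (μ ∷ ν ∷ b ∷ c ∷ [])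
    (S.η̂ S.⊠ quad (Κ (+ 0)) (Ι (# 2)) (Ι (# 3)) (Κ (+ 0)))
    (quad (Ι (# 0) :* Ι (# 2) :+ Ι (# 1) :* Ι (# 3)) (Κ (+ 0)) (Κ (+ 0)) (Ι (# 3) :+ Ι (# 2)))
    refl

  even⇒η-odd : ∀ {u} → Even u → Odd (η̂ ⊠ u)
  even⇒η-odd {quad a _ _ d} (refl , refl) = cong c₀ (η-on-even a d) , cong cμν (η-on-even a d)

  odd⇒η-even : ∀ {u} → Odd u → Even (η̂ ⊠ u)
  odd⇒η-even {quad _ b c _} (refl , refl) = cong cμ (η-on-odd b c) , cong cν (η-on-odd b c)

  InOrderν : ℤ → Quad ℤ → Set
  InOrderν q u = q ∣ₛ cμ u × q ∣ₛ cμν u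

  InOrderμν : ℤ → Quad ℤ → Set
  InOrderμν q u = q ∣ₛ cμ u × q ∣ₛ cν u

  InOrderν-⊠ : ∀ {q} x y → InOrderν q x → InOrderν q y → InOrderν q (x ⊠ y)
  InOrderν-⊠ (quad a b c d) (quad a′ b′ c′ d′) (q∣b , q∣d) (q∣b′ , q∣d′) =
      a *∣ q∣b′ ∣+ q∣b ∣* a′ ∣+ ν *∣ (c *∣ q∣d′ ∣+ q∣d ∣* c′)
    , a *∣ q∣d′ ∣+ q∣d ∣* a′ ∣+ q∣b ∣* c′ ∣+ c *∣ q∣b′

  InOrderμν-⊠ : ∀ {q} x y → InOrderμν q x → InOrderμν q y → InOrderμν q (x ⊠ y)
  InOrderμν-⊠ (quad a b c d) (quad a′ b′ c′ d′) (q∣b , q∣c) (q∣b′ , q∣c′) =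
      a *∣ q∣b′ ∣+ q∣b ∣* a′ ∣+ ν *∣ (q∣c ∣* d′ ∣+ d *∣ q∣c′)
    , a *∣ q∣c′ ∣+ q∣c ∣* a′ ∣+ μ *∣ (q∣b ∣* d′ ∣+ d *∣ q∣b′)

module Model (m : ℤ) where
  open Field m
  open QuadArith ℤ.+-*-rawSemiring m (m + + 1)
  open QuadMonoid m (m + + 1)
  open Grading m (m + + 1)

  private
    -- symbolic elements with the roots kept as variables 0 and 1 (for
    -- transport to K4), resp. with ν = μ + 1 (for identities special to m)
    module Sμν = QuadArith (exprSemiring 10) (Ι (# 0)) (Ι (# 1))
    module S {n} = QuadArith (exprSemiring (ℕ.suc n)) (Ι zero) (Ι zero :+ Κ (+ 1))
    U V : Quad (Expr ℤ 10)
    U = quad (Ι (# 2)) (Ι (# 3)) (Ι (# 4)) (Ι (# 5))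
    V = quad (Ι (# 6)) (Ι (# 7)) (Ι (# 8)) (Ι (# 9))

  emb-⊠ : ∀ u v → emb (u ⊠ v) ≡ emb u ⊛ emb v
  emb-⊠ u v = emb-⟦⟧ (U Sμν.⊠ V) (m ∷ (m + + 1) ∷ coefficients u ++ coefficients v)

  emb-power : ∀ k → emb (power k η̂) ≡ η ^ k
  emb-power ℕ.zero    = refl
  emb-power (ℕ.suc k) = trans (emb-⊠ η̂ (power k η̂)) (cong (η ⊛_) (emb-power k))

  -- M = emb (Quad ℤ) is a ring, so each of its elements lies in O_M.
  InM-emb : ∀ u → InM (emb u)
  InM-emb u = c₀ u , cμ u , cν u , cμν u , refl

  InM-⊛ : ∀ {x y} → InM x → InM y → InM (x ⊛ y)
  InM-⊛ (p , q , r , s , refl) (p′ , q′ , r′ , s′ , refl) =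
    subst InM (emb-⊠ u v) (InM-emb (u ⊠ v))
    where
    u = quad p q r s
    v = quad p′ q′ r′ s′

  InM⇒InCoeffRing : ∀ {α} → InM α → InCoeffRing α
  InM⇒InCoeffRing α∈M x x∈M = InM-⊛ α∈M x∈M

  -- The three Galois conjugates of η; N(η) = (ν − μ)² = 1.
  η̂₁ η̂₂ η̂₃ : Quad ℤ
  η̂₁ = quad (+ 0) -1ℤ (+ 1) (+ 0)
  η̂₂ = quad (+ 0) (+ 1) -1ℤ (+ 0)
  η̂₃ = quad (+ 0) -1ℤ -1ℤ (+ 0)

  conjugates-of-η : η̂ ⊠ η̂₁ ⊠ η̂₂ ⊠ η̂₃ ≡ 𝟙
  conjugates-of-η = by-normalisation (m ∷ [])
    (S.η̂ S.⊠ constant η̂₁ S.⊠ constant η̂₂ S.⊠ constant η̂₃) S.𝟙 refl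

  norm-η : norm η ≡ ℚ.1ℚ
  norm-η = cong a (begin
    η ⊛ σ₁ η ⊛ σ₂ η ⊛ σ₃ η
      ≡⟨ cong (λ x → x ⊛ σ₂ η ⊛ σ₃ η) (emb-⊠ η̂ η̂₁) ⟨
    emb (η̂ ⊠ η̂₁) ⊛ σ₂ η ⊛ σ₃ η
      ≡⟨ cong (_⊛ σ₃ η) (emb-⊠ (η̂ ⊠ η̂₁) η̂₂) ⟨
    emb (η̂ ⊠ η̂₁ ⊠ η̂₂) ⊛ σ₃ η
      ≡⟨ emb-⊠ (η̂ ⊠ η̂₁ ⊠ η̂₂) η̂₃ ⟨
    emb (η̂ ⊠ η̂₁ ⊠ η̂₂ ⊠ η̂₃)
      ≡⟨ cong emb conjugates-of-η ⟩
    oneK ∎)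
    where open ≡-Reasoning

  η-positive-unit : InPosUnits η
  η-positive-unit = InM⇒InCoeffRing (InM-emb η̂) , norm-η

  ε ε⁻¹ : Quad ℤ
  ε   = quad ((+ 2) ℤ.* m + + 1) (+ 0) (+ 0) (+ 2)
  ε⁻¹ = quad ((+ 2) ℤ.* m + + 1) (+ 0) (+ 0) (ℤ.- (+ 2))

  η²≡ε : power 2 η̂ ≡ ε
  η²≡ε = by-normalisation (m ∷ []) (S.η̂ S.⊠ (S.η̂ S.⊠ S.𝟙))
    (quad (Κ (+ 2) :* Ι zero :+ Κ (+ 1)) (Κ (+ 0)) (Κ (+ 0)) (Κ (+ 2))) refl

  ε⊠ε⁻¹ : ε ⊠ ε⁻¹ ≡ 𝟙
  ε⊠ε⁻¹ = by-normalisation (m ∷ [])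
    (quad (Κ (+ 2) :* Ι zero :+ Κ (+ 1)) (Κ (+ 0)) (Κ (+ 0)) (Κ (+ 2))
      S.⊠ quad (Κ (+ 2) :* Ι zero :+ Κ (+ 1)) (Κ (+ 0)) (Κ (+ 0)) (Κ (ℤ.- (+ 2))))
    S.𝟙 refl

  η²-unit : IsUnitInL (η ^ 2)
  η²-unit = subst IsUnitInL (trans (cong emb (sym η²≡ε)) (emb-power 2))
    ( (refl , refl) , InM-emb ε
    , emb ε⁻¹ , (refl , refl) , InM-emb ε⁻¹
    , trans (sym (emb-⊠ ε ε⁻¹)) (cong emb ε⊠ε⁻¹) )

  W : Fin 4 → K4
  W i = emb (basis i)

  coordinates : Quad ℤ → Fin 4 → ℤ
  coordinates u zero                   = cμ u
  coordinates u (suc zero)             = c₀ u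
  coordinates u (suc (suc zero))       = cν u
  coordinates u (suc (suc (suc zero))) = cμν u

  fromCoordinates : (Fin 4 → ℤ) → Quad ℤ
  fromCoordinates z = quad (z (suc zero)) (z zero) (z (suc (suc zero))) (z (suc (suc (suc zero))))

  coordinates-fromCoordinates : ∀ z i → coordinates (fromCoordinates z) i ≡ z i
  coordinates-fromCoordinates z zero                   = refl
  coordinates-fromCoordinates z (suc zero)             = refl
  coordinates-fromCoordinates z (suc (suc zero))       = refl
  coordinates-fromCoordinates z (suc (suc (suc zero))) = refl

  lincomb-W : ∀ z → lincomb z W ≡ emb (fromCoordinates z)
  lincomb-W z = trans (sym (emb-⟦⟧ L (tabulate z)))
                      (cong emb (by-normalisation (tabulate z) L R refl))
    where
    L R : Quad (Expr ℤ 4)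
    L = QuadLinear.combination (exprSemiring 4) Ι (QuadLinear.basis (exprSemiring 4))
    R = quad (Ι (# 1)) (Ι (# 0)) (Ι (# 2)) (Ι (# 3))

  W-basis : IsZBasisM W
  W-basis = (λ i → InM-emb (basis i)) , spanning , independent
    where
    spanning : ∀ x → InM x → Σ (Fin 4 → ℤ) λ z → x ≡ lincomb z W
    spanning x (p , q , r , s , x≡) =
      coordinates (quad p q r s) , trans x≡ (sym (lincomb-W (coordinates (quad p q r s))))
    independent : ∀ z → lincomb z W ≡ zeroK → ∀ i → z i ≡ + 0
    independent z eq i = begin
      z i                                          ≡⟨ coordinates-fromCoordinates z i ⟨
      coordinates (fromCoordinates z) i             ≡⟨ cong (λ u → coordinates u i) z≡0 ⟩
      coordinates (fromCoordinates (λ _ → + 0)) i  ≡⟨ coordinates-fromCoordinates _ i ⟩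
      + 0                                          ∎
      where
      open ≡-Reasoning
      z≡0 : fromCoordinates z ≡ fromCoordinates (λ _ → + 0)
      z≡0 = emb-injective (trans (sym (lincomb-W z)) eq)

  x : ℕ → Fin 4 → ℤ
  x k = coordinates (power k η̂)

  powers-in-W : ∀ k → η ^ k ≡ lincomb (x k) W
  powers-in-W k = trans (sym (emb-power k)) (sym (lincomb-W (x k)))

  -- η⁴ = (4m + 2)η² − 1, where 4m + 2 = ε + ε⁻¹ is the trace of ε = η²;
  -- stated after multiplication by an arbitrary element.
  trace-ε : ℤ
  trace-ε = (+ 4) ℤ.* m + + 2

  η⁴-relation : ∀ u → η̂ ⊠ (η̂ ⊠ (η̂ ⊠ (η̂ ⊠ u))) ≡ trace-ε ⋆ (η̂ ⊠ (η̂ ⊠ u)) ⊞ -1ℤ ⋆ u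
  η⁴-relation u = by-normalisation (m ∷ coefficients u)
    (S.η̂ S.⊠ (S.η̂ S.⊠ (S.η̂ S.⊠ (S.η̂ S.⊠ X))))
    ((Κ (+ 4) :* Ι zero :+ Κ (+ 2)) S.⋆ (S.η̂ S.⊠ (S.η̂ S.⊠ X)) S.⊞ Κ -1ℤ S.⋆ X) refl
    where
    X : Quad (Expr ℤ 5)
    X = quad (Ι (# 1)) (Ι (# 2)) (Ι (# 3)) (Ι (# 4))

  recurrence-coefficients : Fin 4 → ℤ
  recurrence-coefficients zero                   = -1ℤ
  recurrence-coefficients (suc zero)             = + 0
  recurrence-coefficients (suc (suc zero))       = trace-ε
  recurrence-coefficients (suc (suc (suc zero))) = + 0

  x-linRec : LinRec (λ k → x k zero)
  x-linRec = 4 , recurrence-coefficients , recurrence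
    where
    X : ℕ → ℤ
    X k = x k zero
    unfold-sum : ∀ c x₀ x₁ x₂ x₃ →
                 c ℤ.* x₂ ℤ.+ -1ℤ ℤ.* x₀ ≡ -1ℤ ℤ.* x₀ ℤ.+ (+ 0 ℤ.* x₁ ℤ.+ (c ℤ.* x₂ ℤ.+ (+ 0 ℤ.* x₃ ℤ.+ + 0)))
    unfold-sum = solve-∀
    recurrence : ∀ n → X (n ℕ.+ 4) ≡ sumℤ (λ i → recurrence-coefficients i ℤ.* X (n ℕ.+ toℕ i))
    recurrence n = begin
      X (n ℕ.+ 4)
        ≡⟨ cong X (ℕP.+-comm n 4) ⟩
      X (4 ℕ.+ n)
        ≡⟨ cong cμ (η⁴-relation (power n η̂)) ⟩
      trace-ε ℤ.* X (2 ℕ.+ n) ℤ.+ -1ℤ ℤ.* X n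
        ≡⟨ unfold-sum trace-ε (X n) (X (n ℕ.+ 1)) (X (2 ℕ.+ n)) (X (n ℕ.+ 3)) ⟩
      -1ℤ ℤ.* X n ℤ.+ (+ 0 ℤ.* X (n ℕ.+ 1) ℤ.+ (trace-ε ℤ.* X (2 ℕ.+ n) ℤ.+ (+ 0 ℤ.* X (n ℕ.+ 3) ℤ.+ + 0)))
        ≡⟨ cong₂ (λ i j → -1ℤ ℤ.* X i ℤ.+ (+ 0 ℤ.* X (n ℕ.+ 1) ℤ.+ (trace-ε ℤ.* X j ℤ.+ (+ 0 ℤ.* X (n ℕ.+ 3) ℤ.+ + 0))))
                 (sym (ℕP.+-identityʳ n)) (ℕP.+-comm 2 n) ⟩
      sumℤ (λ i → recurrence-coefficients i ℤ.* X (n ℕ.+ toℕ i)) ∎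
      where open ≡-Reasoning

  parity : ∀ k → Even (power k η̂) ⊎ Odd (power k η̂)
  parity ℕ.zero = inj₁ (refl , refl)
  parity (ℕ.suc k) with parity k
  ... | inj₁ even = inj₂ (even⇒η-odd {power k η̂} even)
  ... | inj₂ odd  = inj₁ (odd⇒η-even {power k η̂} odd)

  -- x(n) ∣ x(tn): ηⁿ lies in the order InOrderμν (n even) or InOrderν
  -- (n odd) attached to q = x(n), hence so does (ηⁿ)ᵗ = η^{tn}.
  x-divides : ∀ n t → cμ (power n η̂) ∣ₛ cμ (power (t ℕ.* n) η̂)
  x-divides n t = from-parity (parity n)
    where
    q : ℤ
    q = cμ (power n η̂)
    divides-zero : ∀ {y} → y ≡ + 0 → q ∣ₛ y
    divides-zero refl = ∣-zero
    in-order : (S : Quad ℤ → Set) → S 𝟙 → (∀ x y → S x → S y → S (x ⊠ y)) →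
               S (power n η̂) → S (power (t ℕ.* n) η̂)
    in-order S S𝟙 S⊠ Sηⁿ = subst S (×-assocˡ η̂ t n) (powers-closed S S𝟙 S⊠ Sηⁿ t)
    from-parity : Even (power n η̂) ⊎ Odd (power n η̂) → q ∣ₛ cμ (power (t ℕ.* n) η̂)
    from-parity (inj₁ (_ , cν≡0))  = proj₁ (in-order (InOrderμν q) (∣-zero , ∣-zero) InOrderμν-⊠
                                                      (∣-refl , divides-zero cν≡0))
    from-parity (inj₂ (_ , cμν≡0)) = proj₁ (in-order (InOrderν q) (∣-zero , ∣-zero) InOrderν-⊠
                                                      (∣-refl , divides-zero cμν≡0))

  x-divSeq : DivSeq (λ k → x k zero)
  x-divSeq n k _ _ (t , refl) = ∣⇒∣ᵤ (x-divides n t)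

theorem2 : (m : ℤ) → ¬ IsSquare m → ¬ IsSquare (m + + 1) →
    let open Field m in
      InPosUnits η
      × IsUnitInL (η ^ 2)
      × Σ (Fin 4 → K4) λ w → IsZBasisM w
          × Σ (ℕ → Fin 4 → ℤ) λ x →
              (∀ k → η ^ k ≡ lincomb (x k) w) × IsLDS (λ k → x k zero)
theorem2 m _ _ =
    η-positive-unit
  , η²-unit
  , W , W-basis
  , x , powers-in-W , x-linRec , x-divSeq
  where open Model m
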